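{- Let $G$ be a graph with vertex set $\{v_1,\dots,v_n\}$ and $t$ a positive integer, and let $G'$, $\alpha$, $\beta$ be constructed from $(G,t)$ as described in the context; let $k=n+t+1$ and $\ell=2t+2t^2$. If $\mathcal{C}_k(G')$ contains a path from $\alpha$ to $\beta$ of length at most $\ell$, then $G$ has an independent set of size at least $t-1$.
   Context: A $k$-coloring of a graph is a map from its vertices to $\{1,\dots,k\}$ giving adjacent vertices different colors; $\mathcal{C}_k(H)$ is the graph whose vertices are the $k$-colorings of $H$, two being adjacent iff they differ on exactly one vertex. Construction: $B_t$ is the graph on $\{b^i_j\mid i,j\in\{1,\dots,t\}\}$ with $b^i_j b^{i'}_{j'}$ an edge iff $i\ne i'$ and $j\ne j'$. The graph $G'$ has vertex set $V_G\cup V_B\cup V_C$ (pairwise disjoint), where $V_G=\{g_1,\dots,g_n\}$ induces a copy of $G$ ($g_ig_j$ an edge iff $v_iv_j\in E(G)$), $V_B=\{b^i_j\}$ induces a copy of $B_t$, and $V_C=C_1\cup\dots\cup C_{n+t+1}$ where the $C_i$ are pairwise disjoint sets each of size $2t+2t^2$, and $V_C$ is an independent set. Further edges: all edges between $V_G$ and $V_B$; for each $g_i$, all edges between $g_i$ and $V_C\setminus(C_i\cup C_{n+t+1})$; for each $b\in V_B$, all edges between $b$ and $C_{n+t+1}$. There are no other edges. The coloring $\alpha$ is: $\alpha(g_i)=i$; $\alpha(c)=i$ for every $c\in C_i$; $\alpha(b^i_j)=n+i$. The coloring $\beta$ equals $\alpha$ on $V_G\cup V_C$ and $\beta(b^i_j)=n+j$.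 -}

module Defs where

open import Data.Nat using (ℕ; zero; suc; _+_; _*_; _∸_; _≤_; _<_; s≤s; z≤n)
open import Data.Nat.Properties using (≤-trans; m≤m+n; +-monoʳ-<; +-assoc)
open import Data.Fin using (Fin; toℕ; fromℕ<; inject₁) renaming (zero to fzero; suc to fsuc)
open import Data.Fin.Properties using (toℕ<n)
open import Data.Product using (Σ; ∃; _×_; _,_)
open import Data.Unit using (⊤)
open import Data.Empty using (⊥)
open import Relation.Nullary using (¬_)
open import Relation.Binary.PropositionalEquality using (_≡_; _≢_)

record Graph (n : ℕ) : Set₁ where
  field
    Adj     : Fin n → Fin n → Set
    symm    : ∀ {x y} → Adj x y → Adj y x
    irrefl  : ∀ {x} → ¬ Adj x x
open Graph public

IndependentSetOfSize : ∀ {n} → Graph n → ℕ → Set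
IndependentSetOfSize {n} G m =
  Σ (Fin m → Fin n) λ f →
    (∀ i j → f i ≡ f j → i ≡ j) × (∀ i j → ¬ Adj G (f i) (f j))

ProperColoring : (V : Set) → (V → V → Set) → (k : ℕ) → (V → Fin k) → Set
ProperColoring V E k f = ∀ u v → E u v → f u ≢ f v

DifferOnExactlyOne : ∀ {V : Set} {k} → (V → Fin k) → (V → Fin k) → Set
DifferOnExactlyOne {V} f g = Σ V λ v → (f v ≢ g v) × (∀ w → w ≢ v → f w ≡ g w)

SameColoring : ∀ {V : Set} {k} → (V → Fin k) → (V → Fin k) → Set
SameColoring {V} f g = ∀ v → f v ≡ g v

PathInReconf : (V : Set) → (V → V → Set) → (k : ℕ) →
               (V → Fin k) → (V → Fin k) → ℕ → Set
PathInReconf V E k α β m =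
  Σ (Fin (suc m) → (V → Fin k)) λ x →
      (∀ i → ProperColoring V E k (x i))
    × SameColoring (x fzero) α
    × SameColoring (x (Data.Fin.fromℕ m)) β
    × (∀ (i : Fin m) → DifferOnExactlyOne (x (inject₁ i)) (x (fsuc i)))
    × (∀ i j → SameColoring (x i) (x j) → i ≡ j)

-- The construction G' (0-based indices: g_i for i : Fin n, b^i_j for
-- i j : Fin t, C_j for j : Fin (n+t+1), each C_j of size ℓ = 2t+2t²;
-- the special class C_{n+t+1} is the one with index n+t).

kOf : ℕ → ℕ → ℕ
kOf n t = n + t + 1

ℓOf : ℕ → ℕ
ℓOf t = 2 * t + 2 * (t * t)

data V' (n t : ℕ) : Set where
  gv : Fin n → V' n t
  bv : Fin t → Fin t → V' n t
  cv : Fin (kOf n t) → Fin (ℓOf t) → V' n t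

E' : ∀ {n t} → Graph n → V' n t → V' n t → Set
E' G (gv i) (gv j) = Adj G i j
E' G (gv _) (bv _ _) = ⊤
E' G (bv _ _) (gv _) = ⊤
E' {n} {t} G (gv i) (cv j _) = (toℕ j ≢ toℕ i) × (toℕ j ≢ n + t)
E' {n} {t} G (cv j _) (gv i) = (toℕ j ≢ toℕ i) × (toℕ j ≢ n + t)
E' G (bv i j) (bv i' j') = (i ≢ i') × (j ≢ j')
E' {n} {t} G (bv _ _) (cv j _) = toℕ j ≡ n + t
E' {n} {t} G (cv j _) (bv _ _) = toℕ j ≡ n + t
E' G (cv _ _) (cv _ _) = ⊥

private
  gBound : ∀ {n t} (i : Fin n) → toℕ i < kOf n t
  gBound {n} {t} i = ≤-trans (toℕ<n i) (≤-trans (m≤m+n n t) (m≤m+n (n + t) 1))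

  bBound : ∀ {n t} (i : Fin t) → n + toℕ i < kOf n t
  bBound {n} {t} i =
    ≤-trans (+-monoʳ-< n (toℕ<n i)) (m≤m+n (n + t) 1)

αOf : ∀ n t → V' n t → Fin (kOf n t)
αOf n t (gv i) = fromℕ< (gBound {n} {t} i)
αOf n t (bv i j) = fromℕ< (bBound {n} {t} i)
αOf n t (cv j _) = j

βOf : ∀ n t → V' n t → Fin (kOf n t)
βOf n t (gv i) = fromℕ< (gBound {n} {t} i)
βOf n t (bv i j) = fromℕ< (bBound {n} {t} j)
βOf n t (cv j _) = j

-- Along a recolouring path of length m ≤ ℓ, every class C_j keeps a vertex that is never
-- recoloured: together with b⁰₁, which must change, C_j offers ℓ + 1 > m candidates, while each
-- step recolours a single vertex.  Hence colour j is blocked throughout, so B-vertices never use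
-- the top colour n + t and a vertex g_i that is not coloured top has colour i.
-- Every row of B_t repeats a colour under α, whereas row 0 is rainbow under β.  At the step where
-- this first fails, either every row and all but one column repeat a colour, or some row and some
-- column are rainbow; in both cases B_t shows 2t − 1 distinct colours.  At most t of them lie in
-- [n, n + t), so t − 1 of them are indices i < n, and since g_i is adjacent to all of B_t these
-- g_i all carry the top colour and form an independent set.

module Submission where

open import Defs
open import Data.Nat using (ℕ; zero; suc; _+_; _∸_; _≤_; _<_; z≤n; s≤s)
open import Data.Nat.Properties as ℕ
  using (≤-refl; <⇒≱; 1+n≰n; ≮⇒≥; ≤∧≢⇒<; m<1+n⇒m≤n; m<m+n; +-suc; +-comm; +-cancelˡ-≡;
         ∸-monoˡ-<; m+n∸m≡n; m∸n+n≡m)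
open import Data.Fin using (Fin; toℕ; fromℕ; fromℕ<; inject₁; punchIn; splitAt; join)
  renaming (zero to fzero; suc to fsuc)
open import Data.Fin.Properties
  using (_≟_; any?; all?; ¬∀⟶∃¬; injective⇒≤; toℕ-injective; toℕ-fromℕ<; toℕ<n;
         fromℕ<-injective; suc-injective; punchIn-injective; punchInᵢ≢i; join-splitAt)
open import Data.Vec.Functional using (_∷_)
open import Data.Product using (Σ; ∃; ∃₂; _×_; _,_; proj₁; proj₂; uncurry)
open import Data.Sum using (_⊎_; inj₁; inj₂; [_,_]′)
import Data.Sum as Sum
open import Data.Empty using (⊥-elim)
open import Data.Unit using (tt)
open import Function using (_∘_; flip)
open import Function.Definitions using (Injective)
open import Relation.Nullary using (¬_; yes; no; contradiction)
open import Relation.Nullary.Decidable using (¬?; _×-dec_)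
open import Relation.Unary using (Pred; Decidable; ∁)
open import Relation.Binary using (DecidableEquality)
open import Relation.Binary.PropositionalEquality
open import Level using (0ℓ)

Injective≡ : {A B : Set} → (A → B) → Set
Injective≡ = Injective _≡_ _≡_

exitStep : ∀ {m} {P : Pred (Fin (suc m)) 0ℓ} → Decidable P → P fzero →
           ∀ {τ} → ¬ P τ → ∃ λ i → P (inject₁ i) × ¬ P (fsuc i)
exitStep P? p₀ {fzero} ¬pτ = contradiction p₀ ¬pτ
exitStep {suc m} P? p₀ {fsuc τ} ¬pτ with P? (fsuc fzero)
... | no ¬p₁ = fzero , p₀ , ¬p₁
... | yes p₁ with exitStep (P? ∘ fsuc) p₁ ¬pτ
...   | i , pᵢ , ¬pᵢ₊₁ = fsuc i , pᵢ , ¬pᵢ₊₁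

distinct⇒injective : ∀ {n} {B : Set} {f : Fin n → B} →
                     (∀ {i j} → i ≢ j → f i ≢ f j) → Injective≡ f
distinct⇒injective distinct {i} {j} fi≡fj with i ≟ j
... | yes i≡j = i≡j
... | no i≢j = contradiction fi≡fj (distinct i≢j)

AtLeast : ∀ {a} → ℕ → Pred (Fin a) 0ℓ → Set
AtLeast {a} s P = Σ (Fin s → Fin a) λ h → Injective≡ h × (∀ k → P (h k))

private
  atLeast-shift : ∀ {a s} {P : Pred (Fin (suc a)) 0ℓ} → AtLeast s (P ∘ fsuc) → AtLeast s P
  atLeast-shift (h , h-inj , ph) = fsuc ∘ h , h-inj ∘ suc-injective , ph

  atLeast-cons : ∀ {a s} {P : Pred (Fin (suc a)) 0ℓ} →
                 P fzero → AtLeast s (P ∘ fsuc) → AtLeast (suc s) P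
  atLeast-cons {P = P} p₀ (h , h-inj , ph) = h′ , h′-inj , ph′
    where
    h′ = fzero ∷ fsuc ∘ h
    h′-inj : Injective≡ h′
    h′-inj {fzero} {fzero} _ = refl
    h′-inj {fsuc k} {fsuc l} e = cong fsuc (h-inj (suc-injective e))
    ph′ : ∀ k → P (h′ k)
    ph′ fzero = p₀
    ph′ (fsuc k) = ph k

atLeast⊎atLeast∁ : ∀ {a} s u {P : Pred (Fin a) 0ℓ} → Decidable P → s + u ≤ a →
                   AtLeast s P ⊎ AtLeast (suc u) (∁ P)
atLeast⊎atLeast∁ zero u P? _ = inj₁ ((λ ()) , (λ {}) , (λ ()))
atLeast⊎atLeast∁ {suc a} (suc s) u {P} P? (s≤s s+u≤a) with P? fzero
... | yes p₀ = Sum.map (atLeast-cons {P = P} p₀) (atLeast-shift {P = ∁ P})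
                 (atLeast⊎atLeast∁ s u {P ∘ fsuc} (P? ∘ fsuc) s+u≤a)
atLeast⊎atLeast∁ {suc a} (suc s) zero {P} P? _ | no ¬p₀ =
  inj₂ (atLeast-cons {P = ∁ P} ¬p₀ ((λ ()) , (λ {}) , (λ ())))
atLeast⊎atLeast∁ {suc a} (suc s) (suc u) {P} P? (s≤s s+u≤a) | no ¬p₀ =
  Sum.map (atLeast-shift {P = P}) (atLeast-cons {P = ∁ P} ¬p₀)
    (atLeast⊎atLeast∁ (suc s) u {P ∘ fsuc} (P? ∘ fsuc) (subst (_≤ a) (+-suc s u) s+u≤a))

injective-into-interval⇒≤ : ∀ {q n T} (f : Fin q → ℕ) → Injective≡ f →
                            (∀ z → n ≤ f z) → (∀ z → f z < n + T) → q ≤ T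
injective-into-interval⇒≤ {n = n} {T} f f-inj n≤f f<n+T = injective⇒≤ φ-injective
  where
  offset< : ∀ z → f z ∸ n < T
  offset< z = subst (f z ∸ n <_) (m+n∸m≡n n T) (∸-monoˡ-< (f<n+T z) (n≤f z))
  φ : Fin _ → Fin T
  φ z = fromℕ< (offset< z)
  φ-injective : Injective≡ φ
  φ-injective {z} {z′} e = f-inj (begin
    f z           ≡⟨ m∸n+n≡m (n≤f z) ⟨
    f z ∸ n + n   ≡⟨ cong (_+ n) (fromℕ<-injective _ _ (offset< z) (offset< z′) e) ⟩
    f z′ ∸ n + n  ≡⟨ m∸n+n≡m (n≤f z′) ⟩
    f z′          ∎)
    where open ≡-Reasoning

juxtapose : ∀ {p q} {X : Set} → (Fin p → X) → (Fin q → X) → Fin (p + q) → X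
juxtapose {p} l r = [ l , r ]′ ∘ splitAt p

juxtapose-injective : ∀ {p q} {X Y : Set} (f : X → Y) {l : Fin p → X} {r : Fin q → X} →
                      Injective≡ (f ∘ l) → Injective≡ (f ∘ r) → (∀ a b → f (l a) ≢ f (r b)) →
                      Injective≡ (f ∘ juxtapose l r)
juxtapose-injective {p} {q} f {l} {r} l-inj r-inj apart {z} {z′} e = begin
  z                      ≡⟨ join-splitAt p q z ⟨
  join p q (splitAt p z)  ≡⟨ cong (join p q) (sides (splitAt p z) (splitAt p z′) e) ⟩
  join p q (splitAt p z′) ≡⟨ join-splitAt p q z′ ⟩
  z′                     ∎
  where
  open ≡-Reasoning
  sides : ∀ u v → f ([ l , r ]′ u) ≡ f ([ l , r ]′ v) → u ≡ v
  sides (inj₁ a) (inj₁ a′) e = cong inj₁ (l-inj e)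
  sides (inj₁ a) (inj₂ b) e = contradiction e (apart a b)
  sides (inj₂ b) (inj₁ a) e = contradiction (sym e) (apart a b)
  sides (inj₂ b) (inj₂ b′) e = cong inj₂ (r-inj e)

module Walk {V : Set} {k m : ℕ} (x : Fin (suc m) → V → Fin k)
            (step : ∀ i → DifferOnExactlyOne (x (inject₁ i)) (x (fsuc i))) where

  ChangesAt : Fin m → V → Set
  ChangesAt i w = x (inject₁ i) w ≢ x (fsuc i) w

  agreeOff : ∀ i {w} → w ≢ proj₁ (step i) → x (inject₁ i) w ≡ x (fsuc i) w
  agreeOff i = proj₂ (proj₂ (step i)) _

  changesAt-unique : ∀ {i w w′} → ChangesAt i w → ChangesAt i w′ → ¬ w ≢ w′
  changesAt-unique {i} d d′ w≢w′ =
    d (agreeOff i λ w≡v → d′ (agreeOff i λ w′≡v → w≢w′ (trans w≡v (sym w′≡v))))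

  changesSomewhere : ∀ {w τ} → x fzero w ≢ x τ w → ∃ λ i → ChangesAt i w
  changesSomewhere {w} ne with exitStep (λ σ → x σ w ≟ x fzero w) refl (ne ∘ sym)
  ... | i , same , changed = i , λ e → changed (trans (sym e) same)

  Unchanged : V → Set
  Unchanged w = ∀ τ → x τ w ≡ x fzero w

  -- m steps change at most m vertices.
  someUnchanged : ∀ {p} → m < p → (w : Fin p → V) → Injective≡ w → ∃ λ j → Unchanged (w j)
  someUnchanged m<p w w-inj with any? (λ j → all? (λ τ → x τ (w j) ≟ x fzero (w j)))
  ... | yes found = found
  ... | no none = contradiction (injective⇒≤ stepOf-injective) (<⇒≱ m<p)
    where
    change : ∀ j → ∃ λ i → ChangesAt i (w j)
    change j with ¬∀⟶∃¬ _ _ (λ τ → x τ (w j) ≟ x fzero (w j)) (none ∘ (j ,_))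
    ... | τ , ne = changesSomewhere (ne ∘ sym)
    stepOf-injective : Injective≡ (proj₁ ∘ change)
    stepOf-injective = distinct⇒injective λ {j} {j′} j≢j′ same →
      changesAt-unique (proj₂ (change j))
        (subst (λ i → ChangesAt i (w j′)) (sym same) (proj₂ (change j′)))
        (j≢j′ ∘ w-inj)

HasRepeat : ∀ {T} {A : Set} → (Fin T → A) → Set
HasRepeat f = ∃₂ λ j j′ → j ≢ j′ × f j ≡ f j′

hasRepeat? : ∀ {T} {A : Set} → DecidableEquality A → Decidable (HasRepeat {T} {A})
hasRepeat? _≟ᴬ_ f = any? λ j → any? λ j′ → ¬? (j ≟ j′) ×-dec (f j ≟ᴬ f j′)

¬hasRepeat⇒injective : ∀ {T} {A : Set} {f : Fin T → A} → ¬ HasRepeat f → Injective≡ f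
¬hasRepeat⇒injective none = distinct⇒injective λ j≢j′ e → none (_ , _ , j≢j′ , e)

hasRepeat-cong : ∀ {T} {A : Set} {f g : Fin T → A} → (∀ j → f j ≡ g j) → HasRepeat f → HasRepeat g
hasRepeat-cong f≗g (j , j′ , j≢j′ , e) = j , j′ , j≢j′ , trans (sym (f≗g j)) (trans e (f≗g j′))

repeat-avoiding : ∀ {T} {A : Set} {f : Fin T → A} (h : HasRepeat f) (k : Fin T) →
                  ∃ λ j → j ≢ k × f j ≡ f (proj₁ h)
repeat-avoiding (j , j′ , j≢j′ , e) k with j ≟ k
... | no j≢k = j , j≢k , refl
... | yes refl = j′ , j≢j′ ∘ sym , sym e

ProperB : ∀ {T} {A : Set} → (Fin T → Fin T → A) → Set
ProperB c = ∀ {i j i′ j′} → i ≢ i′ → j ≢ j′ → c i j ≢ c i′ j′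

ProperB-flip : ∀ {T} {A : Set} {c : Fin T → Fin T → A} → ProperB c → ProperB (flip c)
ProperB-flip proper i≢i′ j≢j′ = proper j≢j′ i≢i′

module _ {T} {A : Set} {c : Fin T → Fin T → A} (proper : ProperB c) where

  repeats-in-distinct-rows-differ : ∀ {i i′} → i ≢ i′ →
    (h : HasRepeat (c i)) (h′ : HasRepeat (c i′)) → c i (proj₁ h) ≢ c i′ (proj₁ h′)
  repeats-in-distinct-rows-differ i≢i′ h h′ with repeat-avoiding h′ (proj₁ h)
  ... | j , j≢ , e = subst (c _ (proj₁ h) ≢_) e (proper i≢i′ (j≢ ∘ sym))

  row-repeat≢column-repeat : ∀ {i j} (h : HasRepeat (c i)) (v : HasRepeat (flip c j)) →
                             c i (proj₁ h) ≢ c (proj₁ v) j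
  row-repeat≢column-repeat {i} {j} h v e with repeat-avoiding h j | repeat-avoiding v i
  ... | p , p≢j , ep | r , r≢i , er = proper (r≢i ∘ sym) p≢j (trans ep (trans e (sym er)))

Rainbow : ∀ {T} {A : Set} → (Fin T → Fin T → A) → ℕ → Set
Rainbow {T} c s = Σ (Fin s → Fin T × Fin T) λ R → Injective≡ (uncurry c ∘ R)

module _ {T} {A : Set} {c : Fin (suc T) → Fin (suc T) → A} (proper : ProperB c) where

  rainbowCross : ∀ {i₀ j₀} → Injective≡ (c i₀) → Injective≡ (flip c j₀) → Rainbow c (T + suc T)
  rainbowCross {i₀} {j₀} row₀-inj column₀-inj =
    juxtapose column row , juxtapose-injective (uncurry c) column-inj row₀-inj apart
    where
    column : Fin T → Fin (suc T) × Fin (suc T)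
    column k = punchIn i₀ k , j₀
    row : Fin (suc T) → Fin (suc T) × Fin (suc T)
    row j = i₀ , j
    column-inj : Injective≡ (uncurry c ∘ column)
    column-inj e = punchIn-injective i₀ _ _ (column₀-inj e)
    apart : ∀ k j → c (punchIn i₀ k) j₀ ≢ c i₀ j
    apart k j e with j ≟ j₀
    ... | yes refl = punchInᵢ≢i i₀ k (column₀-inj e)
    ... | no j≢j₀ = proper (punchInᵢ≢i i₀ k) (j≢j₀ ∘ sym) e

  rainbowOfRepeats : (∀ i → HasRepeat (c i)) →
                     ∀ jc → (∀ k → HasRepeat (flip c (punchIn jc k))) → Rainbow c (T + suc T)
  rainbowOfRepeats rows jc columns =
    juxtapose column row , juxtapose-injective (uncurry c) column-inj row-inj apart
    where
    column : Fin T → Fin (suc T) × Fin (suc T)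
    column k = proj₁ (columns k) , punchIn jc k
    row : Fin (suc T) → Fin (suc T) × Fin (suc T)
    row i = i , proj₁ (rows i)
    column-inj : Injective≡ (uncurry c ∘ column)
    column-inj = distinct⇒injective λ k≢k′ →
      repeats-in-distinct-rows-differ (ProperB-flip proper)
        (k≢k′ ∘ punchIn-injective jc _ _) (columns _) (columns _)
    row-inj : Injective≡ (uncurry c ∘ row)
    row-inj = distinct⇒injective λ i≢i′ →
      repeats-in-distinct-rows-differ proper i≢i′ (rows _) (rows _)
    apart : ∀ k i → uncurry c (column k) ≢ uncurry c (row i)
    apart k i e = row-repeat≢column-repeat proper (rows i) (columns k) (sym e)

module Construction (n u : ℕ) (G : Graph n) {m : ℕ} (m≤ℓ : m ≤ ℓOf (suc (suc u)))
  (x : Fin (suc m) → V' n (suc (suc u)) → Fin (kOf n (suc (suc u))))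
  (proper : ∀ τ → ProperColoring (V' n (suc (suc u))) (E' G) (kOf n (suc (suc u))) (x τ))
  (start : SameColoring (x fzero) (αOf n (suc (suc u))))
  (end : SameColoring (x (fromℕ m)) (βOf n (suc (suc u))))
  (step : ∀ i → DifferOnExactlyOne (x (inject₁ i)) (x (fsuc i))) where

  open Walk x step

  t : ℕ
  t = suc (suc u)

  β-row-injective : ∀ {i j j′} → βOf n t (bv i j) ≡ βOf n t (bv i j′) → j ≡ j′
  β-row-injective e = toℕ-injective (+-cancelˡ-≡ n _ _ (fromℕ<-injective _ _ _ _ e))

  -- α(b⁰₁) is definitionally β(b⁰₀).
  b⁰₁-changes : x fzero (bv fzero (fsuc fzero)) ≢ x (fromℕ m) (bv fzero (fsuc fzero))
  b⁰₁-changes e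
    with β-row-injective {fzero} {fzero} {fsuc fzero} (trans (sym (start _)) (trans e (end _)))
  ... | ()

  persistent : ∀ j → ∃ λ c → ∀ τ → x τ (cv j c) ≡ j
  persistent j with someUnchanged (s≤s m≤ℓ) (bv fzero (fsuc fzero) ∷ cv j) witnesses-injective
    where
    witnesses-injective : Injective≡ (bv fzero (fsuc fzero) ∷ cv j)
    witnesses-injective {fzero} {fzero} _ = refl
    witnesses-injective {fsuc c} {fsuc .c} refl = refl
  ... | fzero , unchanged = contradiction (sym (unchanged (fromℕ m))) b⁰₁-changes
  ... | fsuc c , unchanged = c , λ τ → trans (unchanged τ) (start (cv j c))

  top : Fin (kOf n t)
  top = fromℕ< (m<m+n (n + t) (s≤s z≤n))

  toℕ≢n+t : ∀ {c} → c ≢ top → toℕ c ≢ n + t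
  toℕ≢n+t c≢top e = c≢top (toℕ-injective (trans e (sym (toℕ-fromℕ< _))))

  below-top : ∀ c → c ≢ top → toℕ c < n + t
  below-top c c≢top =
    ≤∧≢⇒< (m<1+n⇒m≤n (subst (toℕ c <_) (+-comm (n + t) 1) (toℕ<n c))) (toℕ≢n+t c≢top)

  b-avoids-top : ∀ τ i j → x τ (bv i j) ≢ top
  b-avoids-top τ i j e with persistent top
  ... | c , fixed = proper τ (bv i j) (cv top c) (toℕ-fromℕ< _) (trans e (sym (fixed τ)))

  g-colour : ∀ τ i → x τ (gv i) ≢ top → toℕ (x τ (gv i)) ≡ toℕ i
  g-colour τ i ¬top with toℕ (x τ (gv i)) ℕ.≟ toℕ i | persistent (x τ (gv i))
  ... | yes e | _ = e
  ... | no ne | c , fixed =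
    contradiction (sym (fixed τ)) (proper τ (gv i) (cv _ c) (ne , toℕ≢n+t ¬top))

  g-top : ∀ τ i {p q} → toℕ (x τ (bv p q)) ≡ toℕ i → x τ (gv i) ≡ top
  g-top τ i {p} {q} e with x τ (gv i) ≟ top
  ... | yes g-top = g-top
  ... | no ¬top = contradiction (toℕ-injective (trans (g-colour τ i ¬top) (sym e)))
                                (proper τ (gv i) (bv p q) tt)

  bColouring : Fin (suc m) → Fin t → Fin t → Fin (kOf n t)
  bColouring τ i j = x τ (bv i j)

  bProper : ∀ τ → ProperB (bColouring τ)
  bProper τ i≢i′ j≢j′ = proper τ (bv _ _) (bv _ _) (i≢i′ , j≢j′)

  AllRowsRepeat : Fin (suc m) → Set
  AllRowsRepeat τ = ∀ i → HasRepeat (bColouring τ i)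

  column : V' n t → Fin t
  column (bv _ j) = j
  column _ = fzero

  rainbowAround : ∀ i → AllRowsRepeat (inject₁ i) → ¬ AllRowsRepeat (fsuc i) →
                  ∃ λ τ → Rainbow (bColouring τ) (suc u + t)
  rainbowAround i rowsBefore ¬rowsAfter with all? (hasRepeat? _≟_ ∘ flip (bColouring (fsuc i)))
  ... | yes columnsAfter = inject₁ i , rainbowOfRepeats (bProper _) rowsBefore jc columnsBefore
    where
    jc = column (proj₁ (step i))
    columnsBefore : ∀ k → HasRepeat (flip (bColouring (inject₁ i)) (punchIn jc k))
    columnsBefore k = hasRepeat-cong
      (λ r → sym (agreeOff i (punchInᵢ≢i jc k ∘ cong column)))
      (columnsAfter (punchIn jc k))
  ... | no ¬columnsAfter
    with ¬∀⟶∃¬ _ _ (hasRepeat? _≟_ ∘ bColouring (fsuc i)) ¬rowsAfter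
       | ¬∀⟶∃¬ _ _ (hasRepeat? _≟_ ∘ flip (bColouring (fsuc i))) ¬columnsAfter
  ... | _ , rainbowRow | _ , rainbowColumn =
    fsuc i , rainbowCross (bProper _) (¬hasRepeat⇒injective rainbowRow)
                                      (¬hasRepeat⇒injective rainbowColumn)

  rainbowTime : ∃ λ τ → Rainbow (bColouring τ) (suc u + t)
  rainbowTime with exitStep (λ τ → all? (hasRepeat? _≟_ ∘ bColouring τ)) initially finally
    where
    initially : AllRowsRepeat fzero
    initially i = fzero , fsuc fzero , (λ ()) , trans (start _) (sym (start _))
    finally : ¬ AllRowsRepeat (fromℕ m)
    finally rows with rows fzero
    ... | j , j′ , j≢j′ , e = j≢j′ (β-row-injective {fzero} (trans (sym (end _)) (trans e (end _))))
  ... | i , rowsBefore , ¬rowsAfter = rainbowAround i rowsBefore ¬rowsAfter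

  independentFromRainbow : ∀ τ → Rainbow (bColouring τ) (suc u + t) → IndependentSetOfSize G (suc u)
  independentFromRainbow τ (R , R-inj) =
    Sum.[ lowColoursIndependent , ⊥-elim ∘ fewHighColours ]′
      (atLeast⊎atLeast∁ (suc u) t {Low} (λ z → toℕ (colour z) ℕ.<? n) ≤-refl)
    where
    colour : Fin (suc u + t) → Fin (kOf n t)
    colour = uncurry (bColouring τ) ∘ R
    Low : Pred (Fin (suc u + t)) 0ℓ
    Low z = toℕ (colour z) < n
    fewHighColours : ¬ AtLeast (suc t) (∁ Low)
    fewHighColours (h , h-inj , high) = 1+n≰n (injective-into-interval⇒≤ (toℕ ∘ colour ∘ h)
      (h-inj ∘ R-inj ∘ toℕ-injective) (≮⇒≥ ∘ high) (λ z → below-top _ (b-avoids-top τ _ _)))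
    lowColoursIndependent : AtLeast (suc u) Low → IndependentSetOfSize G (suc u)
    lowColoursIndependent (h , h-inj , low) = vertex , (λ _ _ → vertex-inj) , independent
      where
      vertex : Fin (suc u) → Fin n
      vertex z = fromℕ< (low z)
      vertex-top : ∀ z → x τ (gv (vertex z)) ≡ top
      vertex-top z = g-top τ (vertex z) (sym (toℕ-fromℕ< (low z)))
      vertex-inj : Injective≡ vertex
      vertex-inj {z} {z′} e =
        h-inj (R-inj (toℕ-injective (fromℕ<-injective _ _ (low z) (low z′) e)))
      independent : ∀ z z′ → ¬ Adj G (vertex z) (vertex z′)
      independent z z′ adj =
        proper τ (gv _) (gv _) adj (trans (vertex-top z) (sym (vertex-top z′)))

  independentSet : IndependentSetOfSize G (suc u)
  independentSet = independentFromRainbow (proj₁ rainbowTime) (proj₂ rainbowTime)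

mainTheorem7 : (n t : ℕ) (G : Graph n) → 1 ≤ t →
    (Σ ℕ λ m → m ≤ ℓOf t × PathInReconf (V' n t) (E' G) (kOf n t) (αOf n t) (βOf n t) m) →
    Σ ℕ λ s → (t ∸ 1 ≤ s) × IndependentSetOfSize G s
mainTheorem7 n zero G () _
mainTheorem7 n (suc zero) G _ _ = 0 , z≤n , (λ ()) , (λ ()) , (λ ())
mainTheorem7 n (suc (suc u)) G _ (m , m≤ℓ , x , proper , start , end , step , _) =
  suc u , ≤-refl , Construction.independentSet n u G m≤ℓ x proper start end step
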